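{- Let $M=(E,\rho)$ be a matroid of rank $d\ge1$, let $0\le i\le d-1$, and let $S\in\mathcal{S}_i^M$. Then $(-1)^{\#S-d+1+i}\mu_i^M(S)\ge0$. Moreover, if $S$ contains no loops of $M$ then $(-1)^{\#S-d+1+i}\mu_i^M(S)>0$.
   Context: For a matroid $M=(E,\rho)$ of rank $d=\rho(E)\ge1$ and $0\le i\le d-1$, let $\mathcal{S}_i^M=\{S\subseteq E:\rho(S)\ge d-i\}$ ordered by inclusion, $\mathcal{L}_i^M=\{\hat0\}\oplus\mathcal{S}_i^M$ (new minimum adjoined), and $\mu_i^M(S)$ the Möbius function $\mu(\hat0,S)$ of $\mathcal{L}_i^M$. -}

module Defs where

open import Data.Nat as ℕ using (ℕ; zero; suc; _∸_; _+_)
open import Data.Integer as ℤ using (ℤ; +_; -_; -1ℤ; 1ℤ; 0ℤ)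
open import Data.Integer.Properties using ()
open import Data.Bool using (true; false)
open import Data.Fin using (Fin)
open import Data.Fin.Subset using (Subset; _⊆_; _⊂_; _∪_; _∩_; ∣_∣; ⁅_⁆; ⊥; _∈_)
open import Data.Fin.Subset.Properties using (_⊂?_)
open import Data.Vec using ([]; _∷_)
open import Data.List using (List; []; _∷_; map; _++_; filter; foldr)
open import Relation.Nullary.Decidable using (_×-dec_)

record Matroid (n : ℕ) : Set where
  field
    ρ         : Subset n → ℕ
    ρ-bounded : ∀ X → ρ X ℕ.≤ ∣ X ∣
    ρ-mono    : ∀ {X Y} → X ⊆ Y → ρ X ℕ.≤ ρ Y
    ρ-submod  : ∀ X Y → ρ (X ∪ Y) + ρ (X ∩ Y) ℕ.≤ ρ X + ρ Y

open Matroid public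

rank : ∀ {n} → Matroid n → ℕ
rank {n} M = ρ M Data.Fin.Subset.⊤

allSubsets : (n : ℕ) → List (Subset n)
allSubsets zero    = [] ∷ []
allSubsets (suc n) = map (false ∷_) (allSubsets n) ++ map (true ∷_) (allSubsets n)

sumℤ : List ℤ → ℤ
sumℤ = foldr ℤ._+_ 0ℤ

InS : ∀ {n} → Matroid n → ℕ → Subset n → Set
InS M i S = rank M ∸ i ℕ.≤ ρ M S

-- Möbius function μ(0̂, S) of L_i^M = {0̂} ⊕ S_i^M, by the standard recursion
--   μ(0̂,S) = - Σ_{0̂ ≤ T < S} μ(0̂,T) = -(1 + Σ_{T ∈ S_i, T ⊊ S} μ(0̂,T)),
-- computed with a fuel bound k ≥ ∣ S ∣ (proper subsets are strictly smaller).
μF : ∀ {n} → Matroid n → ℕ → ℕ → Subset n → ℤ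
μF M i zero    S = -1ℤ
μF {n} M i (suc k) S =
  - (1ℤ ℤ.+ sumℤ (map (μF M i k)
       (filter (λ T → (T ⊂? S) ×-dec (rank M ∸ i ℕ.≤? ρ M T)) (allSubsets n))))

μ : ∀ {n} → Matroid n → ℕ → Subset n → ℤ
μ M i S = μF M i ∣ S ∣ S

IsLoop : ∀ {n} → Matroid n → Fin n → Set
IsLoop M e = ρ M ⁅ e ⁆ ≡ 0
  where open import Relation.Binary.PropositionalEquality using (_≡_)

-- the sign (-1)^(#S - d + 1 + i); the exponent is ≥ 0 for S ∈ S_i
sign : ℕ → ℤ
sign zero    = 1ℤ
sign (suc k) = - sign k

{-# OPTIONS --safe #-}
-- Let m = d - i - 1, so that S_i = {S : m < ρ S}. On S_i, μ(0̂, S) = (-1)^∣S∣ c(S) with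
-- c(S) = Σ_{R ⊆ S, ρ R ≤ m} (-1)^∣R∣: by Möbius inversion on the Boolean lattice,
-- T ↦ (-1)^∣T∣ c(T) sums to [ρ S ≤ m] over the T ⊆ S and equals [T = ∅] when ρ T ≤ m,
-- so its sum over the T ⊆ S lying in S_i is -1, which is the recursion defining μ.
-- As ∣S∣ + 1 + i - d = ∣S∣ - m, the claim becomes (-1)^m c(S) ≥ 0.
--
-- In fact (-1)^(m - ρ ∅) c(S) ≥ 0 whenever ρ ∅ ≤ m < ρ S, for every matroid rank function
-- shifted by a constant. This follows by deleting and contracting an element e ∈ S, as
-- c(S) = c_{M∖e}(S - e) - c_{M/e}(S - e): if e is a loop the two terms cancel; otherwise
-- contracting e raises the rank of ∅ by one, so both terms carry the predicted sign.
-- Strict positivity for loopless S survives, since S - e stays loopless in M ∖ e, and in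
-- M / e whenever e is not spanned by S - e.
module Submission where

open import Defs
open import Data.Nat using (ℕ; _∸_; _+_; _≤_)
open import Data.Integer using (_*_; 0ℤ) renaming (_≤_ to _≤ℤ_; _<_ to _<ℤ_)
open import Data.Fin using (Fin)
open import Data.Fin.Subset using (Subset; ∣_∣; _∈_)
open import Data.Product using (_×_)
open import Relation.Nullary using (¬_)

open import Data.Bool using (false; true)
open import Data.Nat using (zero; suc; _<_; _≤?_; _<?_; _≟_; z≤n; s≤s)
import Data.Nat.Properties as ℕₚ
open import Data.Integer as ℤ using (ℤ; -_; _-_; 1ℤ; -1ℤ) renaming (_+_ to _+ℤ_)
import Data.Integer.Properties as ℤₚ
open import Data.Integer.Tactic.RingSolver using (solve-∀)
open import Data.Fin.Subset using (⊥; ⁅_⁆; _⊆_; _⊂_; _∪_; _∩_; Nonempty; Empty)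
open import Data.Fin.Subset.Properties
open import Data.List using ([]; _∷_; map; _++_; filter)
open import Data.List.Properties using (map-++; map-∘; map-cong)
open import Data.Vec using ([]; _∷_; here; there)
open import Data.Product using (_,_; proj₁)
open import Function using (_∘_; _⇔_; Equivalence; mk⇔)
open import Function.Properties.Equivalence using () renaming (sym to ⇔-sym)
open import Relation.Binary using (_Preserves_⟶_)
open import Relation.Nullary using (Dec; yes; no; contradiction)
open import Relation.Nullary.Decidable using (_×-dec_)
open import Relation.Unary using (Decidable)
open import Relation.Binary.PropositionalEquality

⟦_⟧_ : ∀ {P : Set} → Dec P → ℤ → ℤ
⟦ yes _ ⟧ x = x
⟦ no _  ⟧ x = 0ℤ

module _ {P : Set} where

  ⟦⟧-yes : (p : Dec P) → P → ∀ x → ⟦ p ⟧ x ≡ x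
  ⟦⟧-yes (yes _) _       x = refl
  ⟦⟧-yes (no ¬P) P-holds x = contradiction P-holds ¬P

  ⟦⟧-no : (p : Dec P) → ¬ P → ∀ x → ⟦ p ⟧ x ≡ 0ℤ
  ⟦⟧-no (yes P-holds) ¬P x = contradiction P-holds ¬P
  ⟦⟧-no (no _)        _  x = refl

module _ {P Q : Set} where

  ⟦⟧-cong : (p : Dec P) (q : Dec Q) → P ⇔ Q → ∀ x → ⟦ p ⟧ x ≡ ⟦ q ⟧ x
  ⟦⟧-cong p (yes Q-holds) P⇔Q x = ⟦⟧-yes p (Equivalence.from P⇔Q Q-holds) x
  ⟦⟧-cong p (no ¬Q)       P⇔Q x = ⟦⟧-no p (¬Q ∘ Equivalence.to P⇔Q) x

  ⟦⟧-+-complement : (p : Dec P) (q : Dec Q) → (P → ¬ Q) → (¬ P → Q) →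
                    ∀ x → ⟦ p ⟧ x +ℤ ⟦ q ⟧ x ≡ x
  ⟦⟧-+-complement (yes _)       (no _)        _     _    x = ℤₚ.+-identityʳ x
  ⟦⟧-+-complement (no _)        (yes _)       _     _    x = ℤₚ.+-identityˡ x
  ⟦⟧-+-complement (yes P-holds) (yes Q-holds) P⇒¬Q _    x = contradiction Q-holds (P⇒¬Q P-holds)
  ⟦⟧-+-complement (no ¬P)       (no ¬Q)       _    ¬P⇒Q x = contradiction (¬P⇒Q ¬P) ¬Q

neg*neg : ∀ a b → - a * - b ≡ a * b
neg*neg = solve-∀

sign² : ∀ k → sign k * sign k ≡ 1ℤ
sign² zero    = refl
sign² (suc k) = trans (neg*neg (sign k) (sign k)) (sign² k)

sign-∸ : ∀ {m s} → m ≤ s → sign (s ∸ m) * sign s ≡ sign m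
sign-∸ {s = s} z≤n = sign² s
sign-∸ {suc m} {suc s} (s≤s m≤s) =
  trans (sym (ℤₚ.neg-distribʳ-* (sign (s ∸ m)) (sign s))) (cong -_ (sign-∸ m≤s))

sign-∸-suc : ∀ {a m} → a < m → sign (m ∸ a) ≡ - sign (m ∸ suc a)
sign-∸-suc {zero}  {suc m} _         = refl
sign-∸-suc {suc a} {suc m} (s≤s a<m) = sign-∸-suc a<m

-- Sums over the subsets of a set

Σ⊆ : ∀ {n} → Subset n → (Subset n → ℤ) → ℤ
Σ⊆ {zero}  []          φ = φ []
Σ⊆ {suc n} (false ∷ S) φ = Σ⊆ S (φ ∘ (false ∷_))
Σ⊆ {suc n} (true ∷ S)  φ = Σ⊆ S (φ ∘ (false ∷_)) +ℤ Σ⊆ S (φ ∘ (true ∷_))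

infix 5 Σ⊆
syntax Σ⊆ S (λ T → e) = Σ[ T ⊆ S ] e

Σ⊆-cong : ∀ {n} (S : Subset n) {φ ψ : Subset n → ℤ} →
          (∀ T → φ T ≡ ψ T) → Σ⊆ S φ ≡ Σ⊆ S ψ
Σ⊆-cong {zero}  []          φ≗ψ = φ≗ψ []
Σ⊆-cong {suc n} (false ∷ S) φ≗ψ = Σ⊆-cong S (φ≗ψ ∘ (false ∷_))
Σ⊆-cong {suc n} (true ∷ S)  φ≗ψ =
  cong₂ _+ℤ_ (Σ⊆-cong S (φ≗ψ ∘ (false ∷_))) (Σ⊆-cong S (φ≗ψ ∘ (true ∷_)))

Σ⊆-+ : ∀ {n} (S : Subset n) (φ ψ : Subset n → ℤ) →
       Σ[ T ⊆ S ] (φ T +ℤ ψ T) ≡ Σ⊆ S φ +ℤ Σ⊆ S ψ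
Σ⊆-+ {zero}  []          φ ψ = refl
Σ⊆-+ {suc n} (false ∷ S) φ ψ = Σ⊆-+ S _ _
Σ⊆-+ {suc n} (true ∷ S)  φ ψ = begin
  Σ⊆ S (λ T → φ₀ T +ℤ ψ₀ T) +ℤ Σ⊆ S (λ T → φ₁ T +ℤ ψ₁ T)
    ≡⟨ cong₂ _+ℤ_ (Σ⊆-+ S φ₀ ψ₀) (Σ⊆-+ S φ₁ ψ₁) ⟩
  (Σ⊆ S φ₀ +ℤ Σ⊆ S ψ₀) +ℤ (Σ⊆ S φ₁ +ℤ Σ⊆ S ψ₁)
    ≡⟨ swap-middle (Σ⊆ S φ₀) (Σ⊆ S ψ₀) (Σ⊆ S φ₁) (Σ⊆ S ψ₁) ⟩
  (Σ⊆ S φ₀ +ℤ Σ⊆ S φ₁) +ℤ (Σ⊆ S ψ₀ +ℤ Σ⊆ S ψ₁) ∎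
  where
  open ≡-Reasoning
  φ₀ φ₁ ψ₀ ψ₁ : Subset n → ℤ
  φ₀ = φ ∘ (false ∷_)
  φ₁ = φ ∘ (true ∷_)
  ψ₀ = ψ ∘ (false ∷_)
  ψ₁ = ψ ∘ (true ∷_)
  swap-middle : ∀ a b c d → (a +ℤ b) +ℤ (c +ℤ d) ≡ (a +ℤ c) +ℤ (b +ℤ d)
  swap-middle = solve-∀

Σ⊆-neg : ∀ {n} (S : Subset n) (φ : Subset n → ℤ) → Σ[ T ⊆ S ] - φ T ≡ - Σ⊆ S φ
Σ⊆-neg {zero}  []          φ = refl
Σ⊆-neg {suc n} (false ∷ S) φ = Σ⊆-neg S _
Σ⊆-neg {suc n} (true ∷ S)  φ =
  trans (cong₂ _+ℤ_ (Σ⊆-neg S _) (Σ⊆-neg S _))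
        (sym (ℤₚ.neg-distrib-+ (Σ⊆ S (φ ∘ (false ∷_))) (Σ⊆ S (φ ∘ (true ∷_)))))

Σ⊆-zero : ∀ {n} (S : Subset n) → Σ[ T ⊆ S ] 0ℤ ≡ 0ℤ
Σ⊆-zero {zero}  []          = refl
Σ⊆-zero {suc n} (false ∷ S) = Σ⊆-zero S
Σ⊆-zero {suc n} (true ∷ S)  = cong₂ _+ℤ_ (Σ⊆-zero S) (Σ⊆-zero S)

δ⊥ : ∀ {n} → Subset n → ℤ
δ⊥ []          = 1ℤ
δ⊥ (false ∷ S) = δ⊥ S
δ⊥ (true ∷ S)  = 0ℤ

δ⊥-⊥ : ∀ n → δ⊥ (⊥ {n}) ≡ 1ℤ
δ⊥-⊥ zero    = refl
δ⊥-⊥ (suc n) = δ⊥-⊥ n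

δ⊥-empty : ∀ {n} {S : Subset n} → Empty S → δ⊥ S ≡ 1ℤ
δ⊥-empty {n} empty = trans (cong δ⊥ (Empty-unique empty)) (δ⊥-⊥ n)

δ⊥-nonempty : ∀ {n} {S : Subset n} → ¬ Empty S → δ⊥ S ≡ 0ℤ
δ⊥-nonempty {S = []}        ¬empty = contradiction (λ ()) ¬empty
δ⊥-nonempty {S = true ∷ S}  _      = refl
δ⊥-nonempty {S = false ∷ S} ¬empty =
  δ⊥-nonempty λ empty → ¬empty λ { (Fin.suc x , there x∈S) → empty (x , x∈S) }

0≤δ⊥ : ∀ {n} (S : Subset n) → 0ℤ ≤ℤ δ⊥ S
0≤δ⊥ []          = ℤ.+≤+ z≤n
0≤δ⊥ (false ∷ S) = 0≤δ⊥ S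
0≤δ⊥ (true ∷ S)  = ℤ.+≤+ z≤n

sign∣∣*δ⊥ : ∀ {n} (S : Subset n) → sign ∣ S ∣ * δ⊥ S ≡ δ⊥ S
sign∣∣*δ⊥ []          = refl
sign∣∣*δ⊥ (false ∷ S) = sign∣∣*δ⊥ S
sign∣∣*δ⊥ (true ∷ S)  = ℤₚ.*-zeroʳ (sign ∣ true ∷ S ∣)

Σ⊆-δ⊥ : ∀ {n} (S : Subset n) (φ : Subset n → ℤ) → Σ[ T ⊆ S ] δ⊥ T * φ T ≡ φ ⊥
Σ⊆-δ⊥ {zero}  []          φ = ℤₚ.*-identityˡ (φ [])
Σ⊆-δ⊥ {suc n} (false ∷ S) φ = Σ⊆-δ⊥ S _
Σ⊆-δ⊥ {suc n} (true ∷ S)  φ = begin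
  Σ⊆ S (λ T → δ⊥ T * φ (false ∷ T)) +ℤ Σ⊆ S (λ T → 0ℤ * φ (true ∷ T))
    ≡⟨ cong₂ _+ℤ_ (Σ⊆-δ⊥ S _) (Σ⊆-zero S) ⟩
  φ ⊥ +ℤ 0ℤ
    ≡⟨ ℤₚ.+-identityʳ (φ ⊥) ⟩
  φ ⊥ ∎
  where open ≡-Reasoning

Σ⊆-inversion : ∀ {n} (S : Subset n) (g : Subset n → ℤ) →
               Σ[ T ⊆ S ] sign ∣ T ∣ * (Σ[ R ⊆ T ] sign ∣ R ∣ * g R) ≡ g S
Σ⊆-inversion {zero}  []          g = trans (ℤₚ.*-identityˡ _) (ℤₚ.*-identityˡ (g []))
Σ⊆-inversion {suc n} (false ∷ S) g = Σ⊆-inversion S (g ∘ (false ∷_))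
Σ⊆-inversion {suc n} (true ∷ S)  g = begin
  Σ⊆ S ψ₀ +ℤ (Σ[ T ⊆ S ] - sign ∣ T ∣ * (A₀ T +ℤ (Σ[ R ⊆ T ] - sign ∣ R ∣ * g₁ R)))
    ≡⟨ cong (Σ⊆ S ψ₀ +ℤ_) (Σ⊆-cong S contracted-term) ⟩
  Σ⊆ S ψ₀ +ℤ (Σ[ T ⊆ S ] (- ψ₀ T +ℤ ψ₁ T))
    ≡⟨ cong (Σ⊆ S ψ₀ +ℤ_) (trans (Σ⊆-+ S _ ψ₁) (cong (_+ℤ Σ⊆ S ψ₁) (Σ⊆-neg S ψ₀))) ⟩
  Σ⊆ S ψ₀ +ℤ (- Σ⊆ S ψ₀ +ℤ Σ⊆ S ψ₁)
    ≡⟨ cancel (Σ⊆ S ψ₀) (Σ⊆ S ψ₁) ⟩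
  Σ⊆ S ψ₁
    ≡⟨ Σ⊆-inversion S g₁ ⟩
  g₁ S ∎
  where
  open ≡-Reasoning
  g₀ g₁ A₀ A₁ ψ₀ ψ₁ : Subset n → ℤ
  g₀ = g ∘ (false ∷_)
  g₁ = g ∘ (true ∷_)
  A₀ T = Σ[ R ⊆ T ] sign ∣ R ∣ * g₀ R
  A₁ T = Σ[ R ⊆ T ] sign ∣ R ∣ * g₁ R
  ψ₀ T = sign ∣ T ∣ * A₀ T
  ψ₁ T = sign ∣ T ∣ * A₁ T

  cancel : ∀ a b → a +ℤ (- a +ℤ b) ≡ b
  cancel = solve-∀

  distribute : ∀ s a b → - s * (a - b) ≡ - (s * a) +ℤ s * b
  distribute = solve-∀

  contracted-term : ∀ T →
    - sign ∣ T ∣ * (A₀ T +ℤ (Σ[ R ⊆ T ] - sign ∣ R ∣ * g₁ R)) ≡ - ψ₀ T +ℤ ψ₁ T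
  contracted-term T = begin
    - sign ∣ T ∣ * (A₀ T +ℤ (Σ[ R ⊆ T ] - sign ∣ R ∣ * g₁ R))
      ≡⟨ cong (λ z → - sign ∣ T ∣ * (A₀ T +ℤ z)) (trans (Σ⊆-cong T negate-sign) (Σ⊆-neg T _)) ⟩
    - sign ∣ T ∣ * (A₀ T - A₁ T)
      ≡⟨ distribute (sign ∣ T ∣) (A₀ T) (A₁ T) ⟩
    - ψ₀ T +ℤ ψ₁ T ∎
    where
    negate-sign : ∀ R → - sign ∣ R ∣ * g₁ R ≡ - (sign ∣ R ∣ * g₁ R)
    negate-sign R = sym (ℤₚ.neg-distribˡ-* (sign ∣ R ∣) (g₁ R))

ΣAll : ∀ n → (Subset n → ℤ) → ℤ
ΣAll n φ = sumℤ (map φ (allSubsets n))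

sumℤ-++ : ∀ xs ys → sumℤ (xs ++ ys) ≡ sumℤ xs +ℤ sumℤ ys
sumℤ-++ []       ys = sym (ℤₚ.+-identityˡ (sumℤ ys))
sumℤ-++ (x ∷ xs) ys =
  trans (cong (x +ℤ_) (sumℤ-++ xs ys)) (sym (ℤₚ.+-assoc x (sumℤ xs) (sumℤ ys)))

sumℤ-filter : ∀ {A : Set} {P : A → Set} (P? : Decidable P) (φ : A → ℤ) xs →
              sumℤ (map φ (filter P? xs)) ≡ sumℤ (map (λ x → ⟦ P? x ⟧ φ x) xs)
sumℤ-filter P? φ []       = refl
sumℤ-filter P? φ (x ∷ xs) with P? x
... | yes _ = cong (φ x +ℤ_) (sumℤ-filter P? φ xs)
... | no  _ = trans (sumℤ-filter P? φ xs) (sym (ℤₚ.+-identityˡ _))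

ΣAll-cong : ∀ n {φ ψ : Subset n → ℤ} → (∀ T → φ T ≡ ψ T) → ΣAll n φ ≡ ΣAll n ψ
ΣAll-cong n φ≗ψ = cong sumℤ (map-cong φ≗ψ (allSubsets n))

ΣAll-split : ∀ n (φ : Subset (suc n) → ℤ) →
             ΣAll (suc n) φ ≡ ΣAll n (φ ∘ (false ∷_)) +ℤ ΣAll n (φ ∘ (true ∷_))
ΣAll-split n φ = begin
  sumℤ (map φ (map (false ∷_) Ts ++ map (true ∷_) Ts))
    ≡⟨ cong sumℤ (map-++ φ (map (false ∷_) Ts) (map (true ∷_) Ts)) ⟩
  sumℤ (map φ (map (false ∷_) Ts) ++ map φ (map (true ∷_) Ts))
    ≡⟨ sumℤ-++ (map φ (map (false ∷_) Ts)) (map φ (map (true ∷_) Ts)) ⟩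
  sumℤ (map φ (map (false ∷_) Ts)) +ℤ sumℤ (map φ (map (true ∷_) Ts))
    ≡⟨ sym (cong₂ (λ xs ys → sumℤ xs +ℤ sumℤ ys) (map-∘ Ts) (map-∘ Ts)) ⟩
  ΣAll n (φ ∘ (false ∷_)) +ℤ ΣAll n (φ ∘ (true ∷_)) ∎
  where
  open ≡-Reasoning
  Ts = allSubsets n

ΣAll-step : ∀ n {φ : Subset (suc n) → ℤ} {a b} →
            ΣAll n (φ ∘ (false ∷_)) ≡ a → ΣAll n (φ ∘ (true ∷_)) ≡ b → ΣAll (suc n) φ ≡ a +ℤ b
ΣAll-step n {φ} ≡a ≡b = trans (ΣAll-split n φ) (cong₂ _+ℤ_ ≡a ≡b)

ΣAll-zero : ∀ n → ΣAll n (λ _ → 0ℤ) ≡ 0ℤ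
ΣAll-zero zero    = refl
ΣAll-zero (suc n) = ΣAll-step n (ΣAll-zero n) (ΣAll-zero n)

ΣAll-⊆ : ∀ {n} (S : Subset n) (φ : Subset n → ℤ) → ΣAll n (λ T → ⟦ T ⊆? S ⟧ φ T) ≡ Σ⊆ S φ
ΣAll-⊆ {zero} [] φ =
  trans (cong (_+ℤ 0ℤ) (⟦⟧-yes ([] ⊆? []) (⊆-refl {x = []}) (φ []))) (ℤₚ.+-identityʳ (φ []))
ΣAll-⊆ {suc n} (false ∷ S) φ = trans
  (ΣAll-step n
    (trans (ΣAll-cong n λ T → ⟦⟧-cong (false ∷ T ⊆? false ∷ S) (T ⊆? S) (⇔-sym out⊆-⇔) _) (ΣAll-⊆ S _))
    (ΣAll-zero n))
  (ℤₚ.+-identityʳ _)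
ΣAll-⊆ {suc n} (true ∷ S) φ = ΣAll-step n
  (trans (ΣAll-cong n λ T → ⟦⟧-cong (false ∷ T ⊆? true ∷ S) (T ⊆? S) (⇔-sym out⊆-⇔) _) (ΣAll-⊆ S _))
  (trans (ΣAll-cong n λ T → ⟦⟧-cong (true ∷ T ⊆? true ∷ S) (T ⊆? S) (⇔-sym in⊆in-⇔) _) (ΣAll-⊆ S _))

ΣAll-⊂ : ∀ {n} (S : Subset n) (φ : Subset n → ℤ) →
         ΣAll n (λ T → ⟦ T ⊂? S ⟧ φ T) ≡ Σ⊆ S φ - φ S
ΣAll-⊂ {zero} [] φ =
  trans (cong (_+ℤ 0ℤ) (⟦⟧-no ([] ⊂? []) (⊂-irref {x = []} refl) (φ []))) (sym (ℤₚ.+-inverseʳ (φ [])))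
ΣAll-⊂ {suc n} (false ∷ S) φ = trans
  (ΣAll-step n
    (trans (ΣAll-cong n λ T → ⟦⟧-cong (false ∷ T ⊂? false ∷ S) (T ⊂? S) (⇔-sym out⊂out-⇔) _) (ΣAll-⊂ S _))
    (ΣAll-zero n))
  (ℤₚ.+-identityʳ _)
ΣAll-⊂ {suc n} (true ∷ S) φ = trans
  (ΣAll-step n
    (trans (ΣAll-cong n λ T → ⟦⟧-cong (false ∷ T ⊂? true ∷ S) (T ⊆? S) (⇔-sym out⊂in-⇔) _) (ΣAll-⊆ S _))
    (trans (ΣAll-cong n λ T → ⟦⟧-cong (true ∷ T ⊂? true ∷ S) (T ⊂? S) (mk⇔ drop-∷-⊂ s⊂s) _) (ΣAll-⊂ S _)))
  (sym (ℤₚ.+-assoc (Σ⊆ S (φ ∘ (false ∷_))) (Σ⊆ S (φ ∘ (true ∷_))) (- φ (true ∷ S))))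

-- Shifted rank functions, deletion and contraction

Monotone : ∀ {n} → (Subset n → ℕ) → Set
Monotone f = f Preserves _⊆_ ⟶ _≤_

deletion contraction : ∀ {n} → (Subset (suc n) → ℕ) → Subset n → ℕ
deletion    f T = f (false ∷ T)
contraction f T = f (true ∷ T)

deletion-mono : ∀ {n} {f : Subset (suc n) → ℕ} → Monotone f → Monotone (deletion f)
deletion-mono mono T⊆U = mono (s⊆s T⊆U)

contraction-mono : ∀ {n} {f : Subset (suc n) → ℕ} → Monotone f → Monotone (contraction f)
contraction-mono mono T⊆U = mono (s⊆s T⊆U)

-- Rank functions of matroids up to an additive constant; unlike Matroid, this
-- class is closed under contraction.
record IsShiftedRank {n} (f : Subset n → ℕ) : Set where
  field
    mono          : Monotone f
    submod        : ∀ X Y → f (X ∪ Y) + f (X ∩ Y) ≤ f X + f Y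
    unit-increase : ∀ X x → f (X ∪ ⁅ x ⁆) ≤ suc (f X)

ρ-⊥ : ∀ {n} (M : Matroid n) → ρ M ⊥ ≡ 0
ρ-⊥ {n} M = ℕₚ.n≤0⇒n≡0 (subst (ρ M ⊥ ≤_) (∣⊥∣≡0 n) (ρ-bounded M ⊥))

ρ⊥≤ : ∀ {n} (M : Matroid n) m → ρ M ⊥ ≤ m
ρ⊥≤ M m = subst (_≤ m) (sym (ρ-⊥ M)) z≤n

matroid-isShiftedRank : ∀ {n} (M : Matroid n) → IsShiftedRank (ρ M)
matroid-isShiftedRank M =
  record { mono = ρ-mono M ; submod = ρ-submod M ; unit-increase = unit-increase }
  where
  unit-increase : ∀ X x → ρ M (X ∪ ⁅ x ⁆) ≤ suc (ρ M X)
  unit-increase X x = begin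
    ρ M (X ∪ ⁅ x ⁆)                        ≤⟨ ℕₚ.m≤m+n _ _ ⟩
    ρ M (X ∪ ⁅ x ⁆) + ρ M (X ∩ ⁅ x ⁆)      ≤⟨ ρ-submod M X ⁅ x ⁆ ⟩
    ρ M X + ρ M ⁅ x ⁆                      ≤⟨ ℕₚ.+-monoʳ-≤ (ρ M X) ρ⁅x⁆≤1 ⟩
    ρ M X + 1                              ≡⟨ ℕₚ.+-comm (ρ M X) 1 ⟩
    suc (ρ M X)                            ∎
    where
    open ℕₚ.≤-Reasoning
    ρ⁅x⁆≤1 : ρ M ⁅ x ⁆ ≤ 1
    ρ⁅x⁆≤1 = subst (ρ M ⁅ x ⁆ ≤_) (∣⁅x⁆∣≡1 x) (ρ-bounded M ⁅ x ⁆)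

Loopless : ∀ {n} → (Subset n → ℕ) → Subset n → Set
Loopless f S = ∀ x → x ∈ S → f ⊥ < f ⁅ x ⁆

loopless-tail : ∀ {n} {f : Subset (suc n) → ℕ} {b S} → Loopless f (b ∷ S) → Loopless (deletion f) S
loopless-tail loopless x x∈S = loopless (Fin.suc x) (there x∈S)

loopless-nonempty : ∀ {n} {f : Subset n → ℕ} {S} → Monotone f →
                    Loopless f S → Nonempty S → f ⊥ < f S
loopless-nonempty {f = f} {S} mono loopless (x , x∈S) =
  ℕₚ.<-≤-trans (loopless x x∈S) (mono (λ y∈⁅x⁆ → subst (_∈ S) (sym (x∈⁅y⁆⇒x≡y x y∈⁅x⁆)) x∈S))

module _ {n} {f : Subset (suc n) → ℕ} (isRank : IsShiftedRank f) where
  open IsShiftedRank isRank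

  deletion-isShiftedRank : IsShiftedRank (deletion f)
  deletion-isShiftedRank = record
    { mono          = deletion-mono mono
    ; submod        = λ X Y → submod (false ∷ X) (false ∷ Y)
    ; unit-increase = λ X x → unit-increase (false ∷ X) (Fin.suc x)
    }

  contraction-isShiftedRank : IsShiftedRank (contraction f)
  contraction-isShiftedRank = record
    { mono          = contraction-mono mono
    ; submod        = λ X Y → submod (true ∷ X) (true ∷ Y)
    ; unit-increase = λ X x → unit-increase (true ∷ X) (Fin.suc x)
    }

  deletion≤contraction : ∀ T → deletion f T ≤ contraction f T
  deletion≤contraction T = mono (out⊆ ⊆-refl)

  contraction≤1+deletion : ∀ T → contraction f T ≤ suc (deletion f T)
  contraction≤1+deletion T = ℕₚ.≤-trans (mono (s⊆s (p⊆p∪q ⊥))) (unit-increase (false ∷ T) Fin.zero)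

  -- Submodularity for T and the loop {e}.
  loop⇒deletion≡contraction : f ⁅ Fin.zero ⁆ ≡ f ⊥ → ∀ T → deletion f T ≡ contraction f T
  loop⇒deletion≡contraction loop T =
    ℕₚ.≤-antisym (deletion≤contraction T) (ℕₚ.+-cancelʳ-≤ (f ⊥) _ _ (begin
      f (true ∷ T) + f ⊥                         ≤⟨ ℕₚ.+-mono-≤ (mono (s⊆s (p⊆p∪q ⊥))) (mono ⊥⊆) ⟩
      f (true ∷ (T ∪ ⊥)) + f (false ∷ (T ∩ ⊥))  ≤⟨ submod (false ∷ T) ⁅ Fin.zero ⁆ ⟩
      f (false ∷ T) + f ⁅ Fin.zero ⁆            ≡⟨ cong (f (false ∷ T) +_) loop ⟩
      f (false ∷ T) + f ⊥                       ∎))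
    where open ℕₚ.≤-Reasoning

  -- An x ∈ S parallel to e would put e in the span of S (submodularity for {e, x} and S).
  contraction-loopless : ∀ {S} → deletion f S < contraction f S →
                         Loopless f (true ∷ S) → Loopless (contraction f) S
  contraction-loopless {S} e∉spanS loopless x x∈S =
    ℕₚ.≤-<-trans (contraction≤1+deletion ⊥) (ℕₚ.+-cancelˡ-≤ f₀S _ _ (begin
      f₀S + suc (suc (f ⊥))                            ≡⟨ ℕₚ.+-suc f₀S (suc (f ⊥)) ⟩
      suc f₀S + suc (f ⊥)                              ≤⟨ ℕₚ.+-mono-≤ e∉spanS x-nonloop ⟩
      f (true ∷ S) + f (false ∷ ⁅ x ⁆)                 ≤⟨ ℕₚ.+-mono-≤ (mono (s⊆s ⊆∪)) (mono (s⊆s ⊆∩)) ⟩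
      f (true ∷ (⁅ x ⁆ ∪ S)) + f (false ∷ (⁅ x ⁆ ∩ S)) ≤⟨ submod (true ∷ ⁅ x ⁆) (false ∷ S) ⟩
      f (true ∷ ⁅ x ⁆) + f₀S                           ≡⟨ ℕₚ.+-comm (f (true ∷ ⁅ x ⁆)) f₀S ⟩
      f₀S + f (true ∷ ⁅ x ⁆)                           ∎))
    where
    open ℕₚ.≤-Reasoning
    f₀S = f (false ∷ S)
    x-nonloop : f ⊥ < f (false ∷ ⁅ x ⁆)
    x-nonloop = loopless (Fin.suc x) (there x∈S)
    ⊆∪ : S ⊆ ⁅ x ⁆ ∪ S
    ⊆∪ = q⊆p∪q ⁅ x ⁆ S
    ⊆∩ : ⁅ x ⁆ ⊆ ⁅ x ⁆ ∩ S
    ⊆∩ y∈⁅x⁆ = x∈p∩q⁺ (y∈⁅x⁆ , subst (_∈ S) (sym (x∈⁅y⁆⇒x≡y x y∈⁅x⁆)) x∈S)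

-- The sign of the alternating count of low-rank subsets

signedCount : ∀ {n} → (Subset n → ℕ) → ℕ → Subset n → ℤ
signedCount {zero}  f m []          = ⟦ f [] ≤? m ⟧ 1ℤ
signedCount {suc n} f m (false ∷ S) = signedCount (deletion f) m S
signedCount {suc n} f m (true ∷ S)  = signedCount (deletion f) m S - signedCount (contraction f) m S

signedCount-cong : ∀ {n} {f g : Subset n → ℕ} → (∀ T → f T ≡ g T) →
                   ∀ m S → signedCount f m S ≡ signedCount g m S
signedCount-cong {zero}  f≗g m []          = cong (λ a → ⟦ a ≤? m ⟧ 1ℤ) (f≗g [])
signedCount-cong {suc n} f≗g m (false ∷ S) = signedCount-cong (f≗g ∘ (false ∷_)) m S
signedCount-cong {suc n} f≗g m (true ∷ S)  =
  cong₂ _-_ (signedCount-cong (f≗g ∘ (false ∷_)) m S) (signedCount-cong (f≗g ∘ (true ∷_)) m S)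

signedCount≡Σ⊆ : ∀ {n} (f : Subset n → ℕ) m S →
                 signedCount f m S ≡ Σ[ R ⊆ S ] sign ∣ R ∣ * ⟦ f R ≤? m ⟧ 1ℤ
signedCount≡Σ⊆ {zero}  f m []          = sym (ℤₚ.*-identityˡ _)
signedCount≡Σ⊆ {suc n} f m (false ∷ S) = signedCount≡Σ⊆ (deletion f) m S
signedCount≡Σ⊆ {suc n} f m (true ∷ S)  = cong₂ _+ℤ_ (signedCount≡Σ⊆ (deletion f) m S) (begin
  - signedCount (contraction f) m S
    ≡⟨ cong -_ (signedCount≡Σ⊆ (contraction f) m S) ⟩
  - (Σ[ R ⊆ S ] sign ∣ R ∣ * ⟦ contraction f R ≤? m ⟧ 1ℤ)
    ≡⟨ Σ⊆-neg S _ ⟨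
  Σ[ R ⊆ S ] - (sign ∣ R ∣ * ⟦ contraction f R ≤? m ⟧ 1ℤ)
    ≡⟨ Σ⊆-cong S (λ R → ℤₚ.neg-distribˡ-* (sign ∣ R ∣) _) ⟩
  Σ[ R ⊆ S ] - sign ∣ R ∣ * ⟦ contraction f R ≤? m ⟧ 1ℤ ∎)
  where open ≡-Reasoning

signedCount-below : ∀ {n} {f : Subset n → ℕ} → Monotone f →
                    ∀ {m} S → m < f ⊥ → signedCount f m S ≡ 0ℤ
signedCount-below {f = f} mono {m} [] m<f⊥ = ⟦⟧-no (f [] ≤? m) (ℕₚ.<⇒≱ m<f⊥) 1ℤ
signedCount-below mono (false ∷ S) m<f⊥ = signedCount-below (deletion-mono mono) S m<f⊥
signedCount-below mono (true ∷ S)  m<f⊥ =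
  cong₂ _-_ (signedCount-below (deletion-mono mono) S m<f⊥)
            (signedCount-below (contraction-mono mono) S (ℕₚ.<-≤-trans m<f⊥ (mono ⊥⊆)))

signedCount-above : ∀ {n} {f : Subset n → ℕ} → Monotone f →
                    ∀ {m} S → f S ≤ m → signedCount f m S ≡ δ⊥ S
signedCount-above {f = f} mono {m} [] f[]≤m = ⟦⟧-yes (f [] ≤? m) f[]≤m 1ℤ
signedCount-above mono (false ∷ S) fS≤m = signedCount-above (deletion-mono mono) S fS≤m
signedCount-above mono (true ∷ S)  fS≤m = trans
  (cong₂ _-_ (signedCount-above (deletion-mono mono) S (ℕₚ.≤-trans (mono (out⊆ ⊆-refl)) fS≤m))
             (signedCount-above (contraction-mono mono) S fS≤m))
  (ℤₚ.+-inverseʳ (δ⊥ S))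

NonnegPosIf : Set → ℤ → Set
NonnegPosIf P x = (0ℤ ≤ℤ x) × (P → 0ℤ <ℤ x)

module _ {P : Set} where

  NonnegPosIf-resp : ∀ {x y} → x ≡ y → NonnegPosIf P y → NonnegPosIf P x
  NonnegPosIf-resp refl h = h

  NonnegPosIf-weaken : ∀ {Q x} → (Q → P) → NonnegPosIf P x → NonnegPosIf Q x
  NonnegPosIf-weaken Q⇒P (0≤x , 0<x) = 0≤x , 0<x ∘ Q⇒P

  NonnegPosIf-+ : ∀ {x y} → NonnegPosIf P x → 0ℤ ≤ℤ y → NonnegPosIf P (x +ℤ y)
  NonnegPosIf-+ (0≤x , 0<x) 0≤y = ℤₚ.+-mono-≤ 0≤x 0≤y , λ p → ℤₚ.+-mono-<-≤ (0<x p) 0≤y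

  NonnegPosIf-zero : ¬ P → NonnegPosIf P 0ℤ
  NonnegPosIf-zero ¬P = ℤₚ.≤-refl , λ p → contradiction p ¬P

NonnegPosIf-δ⊥ : ∀ {P : Set} {n} (S : Subset n) → (P → Empty S) → NonnegPosIf P (δ⊥ S)
NonnegPosIf-δ⊥ S P⇒empty =
  0≤δ⊥ S , λ p → subst (0ℤ <ℤ_) (sym (δ⊥-empty (P⇒empty p))) (ℤ.+<+ (s≤s z≤n))

*-neg-flip : ∀ {σ τ} y → σ ≡ - τ → σ * - y ≡ τ * y
*-neg-flip {τ = τ} y refl = neg*neg τ y

module NonLoopStep {n} {f : Subset (suc n) → ℕ} (isRank : IsShiftedRank f) {m} (S : Subset n)
  (f⊥≤m : f ⊥ ≤ m) (m<fS : m < f (true ∷ S)) (f⁅e⁆≡1+f⊥ : f ⁅ Fin.zero ⁆ ≡ suc (f ⊥))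
  (ih-deletion : m < deletion f S →
    NonnegPosIf (Loopless (deletion f) S) (sign (m ∸ f ⊥) * signedCount (deletion f) m S))
  (ih-contraction : f ⁅ Fin.zero ⁆ ≤ m → m < contraction f S →
    NonnegPosIf (Loopless (contraction f) S)
                (sign (m ∸ f ⁅ Fin.zero ⁆) * signedCount (contraction f) m S))
  where
  open IsShiftedRank isRank
  open ≡-Reasoning

  σ σₑ G₀ G₁ : ℤ
  σ  = sign (m ∸ f ⊥)
  σₑ = sign (m ∸ f ⁅ Fin.zero ⁆)
  G₀ = signedCount (deletion f) m S
  G₁ = signedCount (contraction f) m S

  σ≡-σₑ : f ⁅ Fin.zero ⁆ ≤ m → σ ≡ - σₑ
  σ≡-σₑ f⁅e⁆≤m = trans (sign-∸-suc (subst (_≤ m) f⁅e⁆≡1+f⊥ f⁅e⁆≤m))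
                       (cong (λ a → - sign (m ∸ a)) (sym f⁅e⁆≡1+f⊥))

  G₁≡0 : m < f ⁅ Fin.zero ⁆ → G₁ ≡ 0ℤ
  G₁≡0 = signedCount-below (contraction-mono mono) S

  ih-deletion′ : m < deletion f S → NonnegPosIf (Loopless f (true ∷ S)) (σ * G₀)
  ih-deletion′ m<f₀S = NonnegPosIf-weaken (loopless-tail {f = f}) (ih-deletion m<f₀S)

  -- If S ∖ e (resp. e) has rank ≤ m, the deletion (resp. contraction) term is known exactly;
  -- otherwise the induction hypothesis applies to it.
  nonloop-case : NonnegPosIf (Loopless f (true ∷ S)) (σ * (G₀ - G₁))
  nonloop-case with deletion f S ≤? m | f ⁅ Fin.zero ⁆ ≤? m
  ... | no f₀S≰m | no f⁅e⁆≰m = NonnegPosIf-resp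
    (begin
      σ * (G₀ - G₁)   ≡⟨ cong (λ z → σ * (G₀ - z)) (G₁≡0 (ℕₚ.≰⇒> f⁅e⁆≰m)) ⟩
      σ * (G₀ - 0ℤ)   ≡⟨ cong (σ *_) (ℤₚ.+-identityʳ G₀) ⟩
      σ * G₀          ∎)
    (ih-deletion′ (ℕₚ.≰⇒> f₀S≰m))
  ... | no f₀S≰m | yes f⁅e⁆≤m = NonnegPosIf-resp
    (begin
      σ * (G₀ - G₁)          ≡⟨ ℤₚ.*-distribˡ-+ σ G₀ (- G₁) ⟩
      σ * G₀ +ℤ σ * - G₁     ≡⟨ cong (σ * G₀ +ℤ_) (*-neg-flip G₁ (σ≡-σₑ f⁅e⁆≤m)) ⟩
      σ * G₀ +ℤ σₑ * G₁      ∎)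
    (NonnegPosIf-+ (ih-deletion′ (ℕₚ.≰⇒> f₀S≰m)) (proj₁ (ih-contraction f⁅e⁆≤m m<fS)))
  ... | yes f₀S≤m | no f⁅e⁆≰m = NonnegPosIf-resp
    (begin
      σ * (G₀ - G₁)
        ≡⟨ cong₂ (λ a z → sign a * (G₀ - z)) (ℕₚ.m≤n⇒m∸n≡0 m≤f⊥) (G₁≡0 (ℕₚ.≰⇒> f⁅e⁆≰m)) ⟩
      1ℤ * (G₀ - 0ℤ)  ≡⟨ ℤₚ.*-identityˡ (G₀ - 0ℤ) ⟩
      G₀ - 0ℤ         ≡⟨ ℤₚ.+-identityʳ G₀ ⟩
      G₀              ≡⟨ signedCount-above (deletion-mono mono) S f₀S≤m ⟩
      δ⊥ S            ∎)
    (NonnegPosIf-δ⊥ S λ loopless nonempty → ℕₚ.<⇒≱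
      (loopless-nonempty (deletion-mono mono) (loopless-tail {f = f} loopless) nonempty)
      (ℕₚ.≤-trans f₀S≤m m≤f⊥))
    where
    m≤f⊥ : m ≤ f ⊥
    m≤f⊥ = ℕₚ.≤-pred (subst (m <_) f⁅e⁆≡1+f⊥ (ℕₚ.≰⇒> f⁅e⁆≰m))
  ... | yes f₀S≤m | yes f⁅e⁆≤m = NonnegPosIf-resp
    (begin
      σ * (G₀ - G₁)   ≡⟨ cong (λ z → σ * (z - G₁)) G₀≡0 ⟩
      σ * (0ℤ - G₁)   ≡⟨ cong (σ *_) (ℤₚ.+-identityˡ (- G₁)) ⟩
      σ * - G₁        ≡⟨ *-neg-flip G₁ (σ≡-σₑ f⁅e⁆≤m) ⟩
      σₑ * G₁         ∎)
    (NonnegPosIf-weaken (contraction-loopless isRank (ℕₚ.≤-<-trans f₀S≤m m<fS))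
                        (ih-contraction f⁅e⁆≤m m<fS))
    where
    S-nonempty : ¬ Empty S
    S-nonempty empty = ℕₚ.<⇒≱ (subst (λ T → m < f (true ∷ T)) (Empty-unique empty) m<fS) f⁅e⁆≤m
    G₀≡0 : G₀ ≡ 0ℤ
    G₀≡0 = trans (signedCount-above (deletion-mono mono) S f₀S≤m) (δ⊥-nonempty S-nonempty)

signedCount-sign : ∀ {n} {f : Subset n → ℕ} → IsShiftedRank f → ∀ {m} S → f ⊥ ≤ m → m < f S →
                   NonnegPosIf (Loopless f S) (sign (m ∸ f ⊥) * signedCount f m S)
signedCount-sign {zero} isRank [] f⊥≤m m<f⊥ = contradiction f⊥≤m (ℕₚ.<⇒≱ m<f⊥)
signedCount-sign {suc n} {f} isRank (false ∷ S) f⊥≤m m<fS =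
  NonnegPosIf-weaken (loopless-tail {f = f})
    (signedCount-sign (deletion-isShiftedRank isRank) S f⊥≤m m<fS)
signedCount-sign {suc n} {f} isRank {m} (true ∷ S) f⊥≤m m<fS with f ⁅ Fin.zero ⁆ ≟ f ⊥
... | yes e-loop = NonnegPosIf-resp
  (trans (cong (sign (m ∸ f ⊥) *_) G≡0) (ℤₚ.*-zeroʳ (sign (m ∸ f ⊥))))
  (NonnegPosIf-zero λ loopless → ℕₚ.<-irrefl (sym e-loop) (loopless Fin.zero here))
  where
  G≡0 : signedCount f m (true ∷ S) ≡ 0ℤ
  G≡0 = trans (cong (_- signedCount (contraction f) m S)
                    (signedCount-cong (loop⇒deletion≡contraction isRank e-loop) m S))
              (ℤₚ.+-inverseʳ (signedCount (contraction f) m S))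
... | no ¬e-loop = NonLoopStep.nonloop-case isRank S f⊥≤m m<fS f⁅e⁆≡1+f⊥
  (signedCount-sign (deletion-isShiftedRank isRank) S f⊥≤m)
  (signedCount-sign (contraction-isShiftedRank isRank) S)
  where
  f⁅e⁆≡1+f⊥ : f ⁅ Fin.zero ⁆ ≡ suc (f ⊥)
  f⁅e⁆≡1+f⊥ = ℕₚ.≤-antisym (contraction≤1+deletion isRank ⊥)
                           (ℕₚ.≤∧≢⇒< (IsShiftedRank.mono isRank ⊥⊆) (¬e-loop ∘ sym))

-- The Möbius function of L_i

μ⁺ : ∀ {n} → (Subset n → ℕ) → ℕ → Subset n → ℤ
μ⁺ f m T = sign ∣ T ∣ * signedCount f m T

Σ⊆-μ⁺ : ∀ {n} (f : Subset n → ℕ) m S → Σ[ T ⊆ S ] μ⁺ f m T ≡ ⟦ f S ≤? m ⟧ 1ℤ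
Σ⊆-μ⁺ f m S = trans (Σ⊆-cong S λ T → cong (sign ∣ T ∣ *_) (signedCount≡Σ⊆ f m T))
                    (Σ⊆-inversion S (λ R → ⟦ f R ≤? m ⟧ 1ℤ))

module _ {n} {f : Subset n → ℕ} (mono : Monotone f) {m} (f⊥≤m : f ⊥ ≤ m) where

  Σ⊆-μ⁺-low : ∀ S → Σ[ T ⊆ S ] ⟦ f T ≤? m ⟧ μ⁺ f m T ≡ 1ℤ
  Σ⊆-μ⁺-low S = begin
    Σ[ T ⊆ S ] ⟦ f T ≤? m ⟧ μ⁺ f m T      ≡⟨ Σ⊆-cong S low-term ⟩
    Σ[ T ⊆ S ] δ⊥ T * ⟦ f T ≤? m ⟧ 1ℤ     ≡⟨ Σ⊆-δ⊥ S (λ T → ⟦ f T ≤? m ⟧ 1ℤ) ⟩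
    ⟦ f ⊥ ≤? m ⟧ 1ℤ                       ≡⟨ ⟦⟧-yes (f ⊥ ≤? m) f⊥≤m 1ℤ ⟩
    1ℤ                                    ∎
    where
    open ≡-Reasoning
    low-term : ∀ T → ⟦ f T ≤? m ⟧ μ⁺ f m T ≡ δ⊥ T * ⟦ f T ≤? m ⟧ 1ℤ
    low-term T with f T ≤? m
    ... | yes fT≤m = trans (cong (sign ∣ T ∣ *_) (signedCount-above mono T fT≤m))
                           (trans (sign∣∣*δ⊥ T) (sym (ℤₚ.*-identityʳ (δ⊥ T))))
    ... | no _     = sym (ℤₚ.*-zeroʳ (δ⊥ T))

  Σ⊆-μ⁺-high : ∀ S → m < f S → Σ[ T ⊆ S ] ⟦ m <? f T ⟧ μ⁺ f m T ≡ -1ℤ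
  Σ⊆-μ⁺-high S m<fS = begin
    high                        ≡⟨ add-sub high low ⟩
    (high +ℤ low) - low         ≡⟨ cong₂ _-_ (trans (sym (Σ⊆-+ S _ _)) (Σ⊆-cong S split)) (Σ⊆-μ⁺-low S) ⟩
    Σ⊆ S (μ⁺ f m) - 1ℤ          ≡⟨ cong (_- 1ℤ) (trans (Σ⊆-μ⁺ f m S) S∉low) ⟩
    0ℤ - 1ℤ                     ∎
    where
    open ≡-Reasoning
    high low : ℤ
    high = Σ[ T ⊆ S ] ⟦ m <? f T ⟧ μ⁺ f m T
    low  = Σ[ T ⊆ S ] ⟦ f T ≤? m ⟧ μ⁺ f m T
    S∉low : ⟦ f S ≤? m ⟧ 1ℤ ≡ 0ℤ
    S∉low = ⟦⟧-no (f S ≤? m) (ℕₚ.<⇒≱ m<fS) 1ℤ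
    add-sub : ∀ x y → x ≡ (x +ℤ y) - y
    add-sub = solve-∀
    split : ∀ T → ⟦ m <? f T ⟧ μ⁺ f m T +ℤ ⟦ f T ≤? m ⟧ μ⁺ f m T ≡ μ⁺ f m T
    split T = ⟦⟧-+-complement (m <? f T) (f T ≤? m) ℕₚ.<⇒≱ ℕₚ.≮⇒≥ (μ⁺ f m T)

module _ {n} (M : Matroid n) {i m} (d∸i≡1+m : rank M ∸ i ≡ suc m) where

  InS⇔ : ∀ T → InS M i T ⇔ m < ρ M T
  InS⇔ T = mk⇔ (subst (_≤ ρ M T) d∸i≡1+m) (subst (_≤ ρ M T) (sym d∸i≡1+m))

  μF≡μ⁺ : ∀ k S → ∣ S ∣ ≤ k → InS M i S → μF M i k S ≡ μ⁺ (ρ M) m S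
  μF≡μ⁺ zero S ∣S∣≤0 S∈Sᵢ = contradiction
    (ℕₚ.≤-trans (ℕₚ.≤-trans (ρ-bounded M S) ∣S∣≤0) z≤n) (ℕₚ.<⇒≱ (Equivalence.to (InS⇔ S) S∈Sᵢ))
  μF≡μ⁺ (suc k) S ∣S∣≤1+k S∈Sᵢ = begin
    - (1ℤ +ℤ sumℤ (map (μF M i k) (filter P? (allSubsets n))))
      ≡⟨ cong (λ z → - (1ℤ +ℤ z)) (sumℤ-filter P? (μF M i k) (allSubsets n)) ⟩
    - (1ℤ +ℤ ΣAll n (λ T → ⟦ P? T ⟧ μF M i k T))
      ≡⟨ cong (λ z → - (1ℤ +ℤ z)) (ΣAll-cong n proper-term) ⟩
    - (1ℤ +ℤ ΣAll n (λ T → ⟦ T ⊂? S ⟧ ⟦ m <? ρ M T ⟧ μ⁺ (ρ M) m T))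
      ≡⟨ cong (λ z → - (1ℤ +ℤ z)) (ΣAll-⊂ S (λ T → ⟦ m <? ρ M T ⟧ μ⁺ (ρ M) m T)) ⟩
    - (1ℤ +ℤ ((Σ[ T ⊆ S ] ⟦ m <? ρ M T ⟧ μ⁺ (ρ M) m T) - ⟦ m <? ρ M S ⟧ μ⁺ (ρ M) m S))
      ≡⟨ cong₂ (λ a b → - (1ℤ +ℤ (a - b)))
               (Σ⊆-μ⁺-high (ρ-mono M) (ρ⊥≤ M m) S m<ρS)
               (⟦⟧-yes (m <? ρ M S) m<ρS _) ⟩
    - (1ℤ +ℤ (-1ℤ - μ⁺ (ρ M) m S))
      ≡⟨ cancel (μ⁺ (ρ M) m S) ⟩
    μ⁺ (ρ M) m S ∎
    where
    open ≡-Reasoning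
    P? : Decidable (λ T → T ⊂ S × InS M i T)
    P? T = (T ⊂? S) ×-dec (rank M ∸ i ≤? ρ M T)
    m<ρS : m < ρ M S
    m<ρS = Equivalence.to (InS⇔ S) S∈Sᵢ
    cancel : ∀ x → - (1ℤ +ℤ (-1ℤ - x)) ≡ x
    cancel = solve-∀
    proper-term : ∀ T → ⟦ P? T ⟧ μF M i k T ≡ ⟦ T ⊂? S ⟧ ⟦ m <? ρ M T ⟧ μ⁺ (ρ M) m T
    proper-term T with T ⊂? S | rank M ∸ i ≤? ρ M T | m <? ρ M T
    ... | no _    | _        | _       = refl
    ... | yes _   | no _     | no _    = refl
    ... | yes T⊂S | yes T∈Sᵢ | yes _   =
      μF≡μ⁺ k T (ℕₚ.≤-pred (ℕₚ.<-≤-trans (p⊂q⇒∣p∣<∣q∣ T⊂S) ∣S∣≤1+k)) T∈Sᵢ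
    ... | yes _   | yes T∈Sᵢ | no m≮ρT = contradiction (Equivalence.to (InS⇔ T) T∈Sᵢ) m≮ρT
    ... | yes _   | no T∉Sᵢ  | yes m<ρT = contradiction (Equivalence.from (InS⇔ T) m<ρT) T∉Sᵢ

  μ≡μ⁺ : ∀ {S} → InS M i S → μ M i S ≡ μ⁺ (ρ M) m S
  μ≡μ⁺ {S} = μF≡μ⁺ ∣ S ∣ S ℕₚ.≤-refl

  sign*μ : ∀ {S} → InS M i S → m ≤ ∣ S ∣ →
           sign (∣ S ∣ ∸ m) * μ M i S ≡ sign m * signedCount (ρ M) m S
  sign*μ {S} S∈Sᵢ m≤∣S∣ = begin
    sign (∣ S ∣ ∸ m) * μ M i S            ≡⟨ cong (sign (∣ S ∣ ∸ m) *_) (μ≡μ⁺ S∈Sᵢ) ⟩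
    sign (∣ S ∣ ∸ m) * (sign ∣ S ∣ * G)   ≡⟨ ℤₚ.*-assoc (sign (∣ S ∣ ∸ m)) (sign ∣ S ∣) G ⟨
    sign (∣ S ∣ ∸ m) * sign ∣ S ∣ * G     ≡⟨ cong (_* G) (sign-∸ m≤∣S∣) ⟩
    sign m * G                           ∎
    where
    open ≡-Reasoning
    G = signedCount (ρ M) m S

∸≡suc∸suc : ∀ {a d} → a < d → d ∸ a ≡ suc (d ∸ suc a)
∸≡suc∸suc {zero}  {suc d} _         = refl
∸≡suc∸suc {suc a} {suc d} (s≤s a<d) = ∸≡suc∸suc a<d

+-∸-shift : ∀ s i {d} → i < d → d ∸ suc i ≤ s → s + 1 + i ∸ d ≡ s ∸ (d ∸ suc i)
+-∸-shift s i {d} i<d m≤s = begin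
  s + 1 + i ∸ d                  ≡⟨ cong (_∸ d) (ℕₚ.+-assoc s 1 i) ⟩
  s + suc i ∸ d                  ≡⟨ cong (λ a → a + suc i ∸ d) (ℕₚ.m∸n+n≡m m≤s) ⟨
  s ∸ m + m + suc i ∸ d          ≡⟨ cong (_∸ d) (ℕₚ.+-assoc (s ∸ m) m (suc i)) ⟩
  s ∸ m + (m + suc i) ∸ d        ≡⟨ cong (λ a → s ∸ m + a ∸ d) (ℕₚ.m∸n+n≡m i<d) ⟩
  s ∸ m + d ∸ d                  ≡⟨ ℕₚ.m+n∸n≡m (s ∸ m) d ⟩
  s ∸ m                          ∎
  where
  open ≡-Reasoning
  m = d ∸ suc i

matroid-loopless : ∀ {n} (M : Matroid n) {S} → (∀ e → e ∈ S → ¬ IsLoop M e) → Loopless (ρ M) S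
matroid-loopless M noLoops x x∈S =
  subst (_< ρ M ⁅ x ⁆) (sym (ρ-⊥ M)) (ℕₚ.n≢0⇒n>0 (noLoops x x∈S))

corollary2p3 : ∀ {n} (M : Matroid n) (i : ℕ) (S : Subset n)
    → 1 ≤ rank M → i + 1 ≤ rank M → InS M i S
    → (0ℤ ≤ℤ sign (∣ S ∣ + 1 + i ∸ rank M) * μ M i S)
      × ((∀ e → e ∈ S → ¬ IsLoop M e) → 0ℤ <ℤ sign (∣ S ∣ + 1 + i ∸ rank M) * μ M i S)
-- The hypothesis 1 ≤ rank M is implied by i + 1 ≤ rank M.
corollary2p3 M i S _ i+1≤d S∈Sᵢ = NonnegPosIf-resp sign*μ≡
  (NonnegPosIf-weaken (matroid-loopless M)
    (signedCount-sign (matroid-isShiftedRank M) S (ρ⊥≤ M m) m<ρS))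
  where
  open ≡-Reasoning
  m = rank M ∸ suc i
  i<d : i < rank M
  i<d = subst (_≤ rank M) (ℕₚ.+-comm i 1) i+1≤d
  d∸i≡1+m : rank M ∸ i ≡ suc m
  d∸i≡1+m = ∸≡suc∸suc i<d
  m<ρS : m < ρ M S
  m<ρS = Equivalence.to (InS⇔ M {i} d∸i≡1+m S) S∈Sᵢ
  m≤∣S∣ : m ≤ ∣ S ∣
  m≤∣S∣ = ℕₚ.<⇒≤ (ℕₚ.<-≤-trans m<ρS (ρ-bounded M S))
  sign*μ≡ : sign (∣ S ∣ + 1 + i ∸ rank M) * μ M i S ≡ sign (m ∸ ρ M ⊥) * signedCount (ρ M) m S
  sign*μ≡ = begin
    sign (∣ S ∣ + 1 + i ∸ rank M) * μ M i S   ≡⟨ cong (λ a → sign a * μ M i S) exponent ⟩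
    sign (∣ S ∣ ∸ m) * μ M i S               ≡⟨ sign*μ M d∸i≡1+m S∈Sᵢ m≤∣S∣ ⟩
    sign m * G                               ≡⟨ cong (λ a → sign (m ∸ a) * G) (ρ-⊥ M) ⟨
    sign (m ∸ ρ M ⊥) * G                     ∎
    where
    G = signedCount (ρ M) m S
    exponent : ∣ S ∣ + 1 + i ∸ rank M ≡ ∣ S ∣ ∸ m
    exponent = +-∸-shift ∣ S ∣ i i<d m≤∣S∣
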